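{- Let $C_0\geq 3\times 10^3$ be an absolute constant, $k\geq 2$, $r\ge 0$ integers and $n\geq C_0(r+1)^3(k+r)k^{2}$. If $\mathcal{F}\subseteq\binom{[n]}{k}$ has size $|\mathcal{F}|=\sum_{i=1}^{r}\binom{n-i}{k-1}+\delta\binom{n-(r+1)}{k-1}$ for some $\delta\in[\frac{150k^3}{n},1]$ and satisfies $\mathcal{I}(\mathcal{F})\geq\frac{r+\delta^2}{(r+\delta)^2}|\mathcal{F}|^2$, then there exists $x\in[n]$ with $|\mathcal{F}(x)|\geq \frac{|\mathcal{F}|}{4(r+1)}$.
   Context: $\binom{[n]}{k}$ is the family of $k$-subsets of $[n]=\{1,\dots,n\}$. For $\mathcal{F}\subseteq\binom{[n]}{k}$ and $x\in[n]$, $\mathcal{F}(x)=\{F\in\mathcal{F}:x\in F\}$, and $\mathcal{I}(\mathcal{F})=\sum_{A,B\in\mathcal{F}}|A\cap B|=\sum_{x\in[n]}|\mathcal{F}(x)|^2$ (ordered pairs, including $A=B$). -}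

module Defs where

open import Data.Nat using (ℕ; zero; suc; _+_; _*_)
open import Data.Integer using (+_)
open import Data.Rational using (ℚ; _/_)
open import Data.List using (List; length; filter; map)
open import Data.Nat.ListAction using (sum)
open import Data.Fin using (Fin)
open import Data.Fin.Subset using (Subset; _∩_; ∣_∣)
open import Data.Fin.Subset.Properties using (_∈?_)

ℕ→ℚ : ℕ → ℚ
ℕ→ℚ m = + m / 1

Σ₁ : ℕ → (ℕ → ℕ) → ℕ
Σ₁ zero    f = 0
Σ₁ (suc r) f = Σ₁ r f + f (suc r)

-- A family of subsets of [n] (represented as Fin n) is a list of subsets;
-- distinctness is imposed separately in the statement.

famAt : ∀ {n} → List (Subset n) → Fin n → List (Subset n)
famAt 𝓕 x = filter (x ∈?_) 𝓕

I : ∀ {n} → List (Subset n) → ℕ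
I 𝓕 = sum (map (λ A → sum (map (λ B → ∣ A ∩ B ∣) 𝓕)) 𝓕)

-- Write m = |𝓕|, d(x) = |𝓕(x)|, R = r + 1 and suppose every degree is below m / 4R.
-- Since (r + δ)² ≤ (r + 1)(r + δ²), the hypothesis on I(𝓕) gives m² ≤ R·I(𝓕) = R·Σ d(x)².
-- Two points lie together in at most C(n−2, k−2) members of 𝓕, so by Bonferroni any t points
-- have total degree at most m + C(t,2)·C(n−2, k−2), and the bounds on n and |𝓕| make
-- C(8kR, 2)·C(n−2, k−2) < m. Hence fewer than 8kR points x are heavy (m ≤ 4kR·d(x)), their
-- total degree is below 2m, and they contribute less than 2m²/4R to Σ d²; the light points
-- contribute at most m²/4R because Σ d = km. So R·Σ d² < 3m²/4, a contradiction.

module Submission where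

open import Defs
open import Data.Nat using (ℕ; _+_; _*_; _∸_; _^_; _≤_)
open import Data.Nat.Combinatorics using (_C_)
open import Data.Rational as ℚ using (ℚ)
open import Data.List using (List; length)
open import Data.List.Relation.Unary.All using (All)
open import Data.List.Relation.Unary.Unique.Propositional using (Unique)
open import Data.Fin using (Fin)
open import Data.Fin.Subset using (Subset; ∣_∣)
open import Data.Product using (∃)
open import Relation.Binary.PropositionalEquality using (_≡_)

open import Level using (Level)
open import Function using (id; _∘_; case_of_)
open import Data.Empty using (⊥)
open import Data.Bool using (Bool; true; false)
open import Data.Product using (_,_)
open import Data.Sum using (inj₁; inj₂; [_,_]′)
open import Data.Nat
  using (zero; suc; _<_; z≤n; s≤s; ≤′-refl; ≤′-step; _≤?_; NonZero; >-nonZero; ≢-nonZero)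
open import Data.Nat.Properties
open import Data.Nat.Combinatorics using (nCk+nC[k+1]≡[n+1]C[k+1]; nC1≡n)
open import Data.Nat.ListAction using (sum)
open import Data.Nat.Tactic.RingSolver using (solve-∀)
import Data.Nat.Coprimality as Coprime
import Data.Integer as ℤ
import Data.Integer.Properties as ℤ
open import Data.Rational using (mkℚ; _/_; 0ℚ; 1ℚ; *≤*; Positive)
import Data.Rational.Properties as ℚ
open import Data.Rational.Solver using (module +-*-Solver)
open import Data.List using ([]; _∷_; map; filter; allFin; take)
import Data.List.Properties as List
open import Data.List.Relation.Unary.All as All using ([]; _∷_)
import Data.List.Relation.Unary.All.Properties as All
open import Data.List.Relation.Unary.All.Properties using (all-filter; filter⁺; ¬Any⇒All¬)
open import Data.List.Relation.Unary.Any using (any?; satisfied)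
open import Data.List.Relation.Unary.AllPairs using ([]; _∷_)
import Data.List.Relation.Unary.Unique.Propositional.Properties as Unique
open import Data.Fin using (zero; suc)
open import Data.Fin.Subset using (_∩_; _∪_; _⊆_; _∈_; ⁅_⁆; inside; outside)
open import Data.Fin.Subset.Properties
  using (_∈?_; drop-∷-⊆; p⊆q⇒∣p∣≤∣q∣; ∣p∣≤n; ∣⁅x⁆∣≡1; x∈⁅y⁆⇒x≡y; x∈p∪q⁻; ∪-identityˡ; ∪-identityʳ)
open import Data.Vec using ([]; _∷_; here)
open import Relation.Binary.PropositionalEquality
  using (_≢_; refl; sym; trans; cong; cong₂; subst; subst₂; module ≡-Reasoning)
open import Relation.Nullary using (¬_; does; yes; no; contradiction)
open import Relation.Unary using (Pred; Decidable; Empty)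
open import Relation.Unary.Properties using (∁?)
import Algebra.Properties.CommutativeSemigroup as CommSemigroupProperties

-- Sums over lists

𝟙 : Bool → ℕ
𝟙 true  = 1
𝟙 false = 0

private
  variable
    a b p : Level
    A : Set a
    B : Set b
    n : ℕ

∑ : List A → (A → ℕ) → ℕ
∑ xs f = sum (map f xs)

syntax ∑ xs (λ x → e) = ∑[ x ∈ xs ] e

∑-cong : ∀ xs {f g : A → ℕ} → (∀ x → f x ≡ g x) → ∑ xs f ≡ ∑ xs g
∑-cong []       f≡g = refl
∑-cong (x ∷ xs) f≡g = cong₂ _+_ (f≡g x) (∑-cong xs f≡g)

∑-mono : ∀ {xs} {f g : A → ℕ} → All (λ x → f x ≤ g x) xs → ∑ xs f ≤ ∑ xs g
∑-mono []          = z≤n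
∑-mono (f≤g ∷ f≤gs) = +-mono-≤ f≤g (∑-mono f≤gs)

∑-const : ∀ (xs : List A) c → ∑[ _ ∈ xs ] c ≡ length xs * c
∑-const []       c = refl
∑-const (x ∷ xs) c = cong (c +_) (∑-const xs c)

∑-const-All : ∀ {xs : List A} {f : A → ℕ} {c} → All (λ x → f x ≡ c) xs → ∑ xs f ≡ length xs * c
∑-const-All []          = refl
∑-const-All (fx≡c ∷ ps) = cong₂ _+_ fx≡c (∑-const-All ps)

∑-+ : ∀ xs (f g : A → ℕ) → ∑[ x ∈ xs ] (f x + g x) ≡ ∑ xs f + ∑ xs g
∑-+ []       f g = refl
∑-+ (x ∷ xs) f g = trans (cong (f x + g x +_) (∑-+ xs f g)) (+-interchange (f x) (g x) _ _)
  where open CommSemigroupProperties +-commutativeSemigroup renaming (interchange to +-interchange)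

∑-*ˡ : ∀ xs c (f : A → ℕ) → ∑[ x ∈ xs ] (c * f x) ≡ c * ∑ xs f
∑-*ˡ []       c f = sym (*-zeroʳ c)
∑-*ˡ (x ∷ xs) c f = trans (cong (c * f x +_) (∑-*ˡ xs c f)) (sym (*-distribˡ-+ c (f x) (∑ xs f)))

∑-*ʳ : ∀ xs (f : A → ℕ) c → ∑[ x ∈ xs ] (f x * c) ≡ ∑ xs f * c
∑-*ʳ xs f c = trans (∑-cong xs (λ x → *-comm (f x) c)) (trans (∑-*ˡ xs c f) (*-comm c (∑ xs f)))

∑-square≤ : ∀ {xs : List A} {f : A → ℕ} c m → All (λ x → c * f x ≤ m) xs →
            c * ∑[ x ∈ xs ] (f x * f x) ≤ m * ∑ xs f
∑-square≤ {xs = xs} {f} c m cf≤m = begin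
  c * ∑[ x ∈ xs ] (f x * f x)   ≡⟨ ∑-*ˡ xs c (λ x → f x * f x) ⟨
  ∑[ x ∈ xs ] (c * (f x * f x)) ≡⟨ ∑-cong xs (λ x → *-assoc c (f x) (f x)) ⟨
  ∑[ x ∈ xs ] (c * f x * f x)   ≤⟨ ∑-mono (All.map (*-monoˡ-≤ _) cf≤m) ⟩
  ∑[ x ∈ xs ] (m * f x)         ≡⟨ ∑-*ˡ xs m f ⟩
  m * ∑ xs f                    ∎
  where open ≤-Reasoning

∑-comm : ∀ (xs : List A) (ys : List B) (f : A → B → ℕ) →
         ∑[ x ∈ xs ] (∑[ y ∈ ys ] f x y) ≡ ∑[ y ∈ ys ] (∑[ x ∈ xs ] f x y)
∑-comm []       ys f = sym (trans (∑-const ys 0) (*-zeroʳ (length ys)))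
∑-comm (x ∷ xs) ys f = trans (cong (∑ ys (f x) +_) (∑-comm xs ys f)) (sym (∑-+ ys (f x) _))

module _ {P : Pred A p} (P? : Decidable P) where

  ∑-filter : ∀ xs (f : A → ℕ) → ∑[ x ∈ xs ] (𝟙 (does (P? x)) * f x) ≡ ∑ (filter P? xs) f
  ∑-filter []       f = refl
  ∑-filter (x ∷ xs) f with P? x
  ... | yes _ = cong₂ _+_ (+-identityʳ (f x)) (∑-filter xs f)
  ... | no _  = ∑-filter xs f

  ∑-partition : ∀ xs (f : A → ℕ) → ∑ xs f ≡ ∑ (filter P? xs) f + ∑ (filter (∁? P?) xs) f
  ∑-partition []       f = refl
  ∑-partition (x ∷ xs) f with P? x
  ... | yes _ = trans (cong (f x +_) (∑-partition xs f)) (sym (+-assoc (f x) _ _))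
  ... | no _  = trans (cong (f x +_) (∑-partition xs f)) (x∙yz≈y∙xz (f x) (∑ (filter P? xs) f) _)
    where open CommSemigroupProperties +-commutativeSemigroup

  length-filter≡∑𝟙 : ∀ xs → length (filter P? xs) ≡ ∑[ x ∈ xs ] 𝟙 (does (P? x))
  length-filter≡∑𝟙 []       = refl
  length-filter≡∑𝟙 (x ∷ xs) with P? x
  ... | yes _ = cong suc (length-filter≡∑𝟙 xs)
  ... | no _  = length-filter≡∑𝟙 xs

-- Incidences and degrees

∑-allFin-suc : ∀ (f : Fin (suc n) → ℕ) → ∑ (allFin (suc n)) f ≡ f zero + ∑[ x ∈ allFin n ] f (suc x)
∑-allFin-suc f = cong (f zero +_) (trans (cong sum (List.map-tabulate suc f))
                                         (sym (cong sum (List.map-tabulate id (f ∘ suc)))))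

⟦_∈_⟧ : Fin n → Subset n → ℕ
⟦ x ∈ A ⟧ = 𝟙 (does (x ∈? A))

∣∣≡∑ : ∀ (A : Subset n) → ∣ A ∣ ≡ ∑[ x ∈ allFin n ] ⟦ x ∈ A ⟧
∣∣≡∑ {zero}  []      = refl
∣∣≡∑ {suc n} (a ∷ A) = trans (split a) (sym (∑-allFin-suc (⟦_∈ a ∷ A ⟧)))
  where
  split : ∀ a → ∣ a ∷ A ∣ ≡ ⟦ zero ∈ a ∷ A ⟧ + ∑[ x ∈ allFin n ] ⟦ x ∈ A ⟧
  split true  = cong suc (∣∣≡∑ A)
  split false = ∣∣≡∑ A

∣∩∣≡∑ : ∀ (A B : Subset n) → ∣ A ∩ B ∣ ≡ ∑[ x ∈ allFin n ] (⟦ x ∈ A ⟧ * ⟦ x ∈ B ⟧)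
∣∩∣≡∑ {zero}  []      []      = refl
∣∩∣≡∑ {suc n} (a ∷ A) (b ∷ B) = trans (split a b) (sym (∑-allFin-suc (λ x → ⟦ x ∈ a ∷ A ⟧ * ⟦ x ∈ b ∷ B ⟧)))
  where
  split : ∀ a b → ∣ (a ∷ A) ∩ (b ∷ B) ∣ ≡
          ⟦ zero ∈ a ∷ A ⟧ * ⟦ zero ∈ b ∷ B ⟧ + ∑[ x ∈ allFin n ] (⟦ x ∈ A ⟧ * ⟦ x ∈ B ⟧)
  split true  true  = cong suc (∣∩∣≡∑ A B)
  split true  false = ∣∩∣≡∑ A B
  split false true  = ∣∩∣≡∑ A B
  split false false = ∣∩∣≡∑ A B

degree : List (Subset n) → Fin n → ℕ
degree 𝓕 x = length (famAt 𝓕 x)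

degree≡∑ : ∀ (𝓕 : List (Subset n)) x → degree 𝓕 x ≡ ∑[ A ∈ 𝓕 ] ⟦ x ∈ A ⟧
degree≡∑ 𝓕 x = length-filter≡∑𝟙 (x ∈?_) 𝓕

∑-degree : ∀ (𝓕 : List (Subset n)) X → ∑ X (degree 𝓕) ≡ ∑[ A ∈ 𝓕 ] (∑[ x ∈ X ] ⟦ x ∈ A ⟧)
∑-degree 𝓕 X = trans (∑-cong X (degree≡∑ 𝓕)) (∑-comm X 𝓕 ⟦_∈_⟧)

∑-degree-allFin : ∀ (𝓕 : List (Subset n)) → ∑ (allFin n) (degree 𝓕) ≡ ∑ 𝓕 ∣_∣
∑-degree-allFin 𝓕 = trans (∑-degree 𝓕 (allFin _)) (sym (∑-cong 𝓕 ∣∣≡∑))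

I≡∑degree² : ∀ (𝓕 : List (Subset n)) → I 𝓕 ≡ ∑[ x ∈ allFin n ] (degree 𝓕 x * degree 𝓕 x)
I≡∑degree² {n} 𝓕 = begin
  ∑[ A ∈ 𝓕 ] (∑[ B ∈ 𝓕 ] ∣ A ∩ B ∣)
    ≡⟨ ∑-cong 𝓕 (λ A → ∑-cong 𝓕 (∣∩∣≡∑ A)) ⟩
  ∑[ A ∈ 𝓕 ] (∑[ B ∈ 𝓕 ] (∑[ x ∈ V ] (⟦ x ∈ A ⟧ * ⟦ x ∈ B ⟧)))
    ≡⟨ ∑-cong 𝓕 (λ A → ∑-comm 𝓕 V (λ B x → ⟦ x ∈ A ⟧ * ⟦ x ∈ B ⟧)) ⟩
  ∑[ A ∈ 𝓕 ] (∑[ x ∈ V ] (∑[ B ∈ 𝓕 ] (⟦ x ∈ A ⟧ * ⟦ x ∈ B ⟧)))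
    ≡⟨ ∑-cong 𝓕 (λ A → ∑-cong V (λ x → ∑-*ˡ 𝓕 ⟦ x ∈ A ⟧ (λ B → ⟦ x ∈ B ⟧))) ⟩
  ∑[ A ∈ 𝓕 ] (∑[ x ∈ V ] (⟦ x ∈ A ⟧ * ∑[ B ∈ 𝓕 ] ⟦ x ∈ B ⟧))
    ≡⟨ ∑-comm 𝓕 V (λ A x → ⟦ x ∈ A ⟧ * ∑[ B ∈ 𝓕 ] ⟦ x ∈ B ⟧) ⟩
  ∑[ x ∈ V ] (∑[ A ∈ 𝓕 ] (⟦ x ∈ A ⟧ * ∑[ B ∈ 𝓕 ] ⟦ x ∈ B ⟧))
    ≡⟨ ∑-cong V (λ x → trans (∑-*ʳ 𝓕 (λ B → ⟦ x ∈ B ⟧) _) (sym (cong₂ _*_ (degree≡∑ 𝓕 x) (degree≡∑ 𝓕 x)))) ⟩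
  ∑[ x ∈ V ] (degree 𝓕 x * degree 𝓕 x) ∎
  where
  open ≡-Reasoning
  V = allFin n

-- Supersets of a fixed set and codegrees

All⇒[] : ∀ {P : Pred A p} {xs} → Empty P → All P xs → xs ≡ []
All⇒[] _ []       = refl
All⇒[] ∅ (px ∷ _) = contradiction px (∅ _)

tailsIn tailsOut : List (Subset (suc n)) → List (Subset n)
tailsIn []                 = []
tailsIn ((true  ∷ A) ∷ 𝓕) = A ∷ tailsIn 𝓕
tailsIn ((false ∷ A) ∷ 𝓕) = tailsIn 𝓕
tailsOut []                 = []
tailsOut ((true  ∷ A) ∷ 𝓕) = tailsOut 𝓕
tailsOut ((false ∷ A) ∷ 𝓕) = A ∷ tailsOut 𝓕

length-tails : ∀ (𝓕 : List (Subset (suc n))) → length 𝓕 ≡ length (tailsIn 𝓕) + length (tailsOut 𝓕)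
length-tails []                 = refl
length-tails ((true  ∷ A) ∷ 𝓕) = cong suc (length-tails 𝓕)
length-tails ((false ∷ A) ∷ 𝓕) = trans (cong suc (length-tails 𝓕)) (sym (+-suc _ _))

module _ {P : Pred (Subset (suc n)) p} where

  All-tailsIn : ∀ {𝓕} → All P 𝓕 → All (λ B → P (inside ∷ B)) (tailsIn 𝓕)
  All-tailsIn {[]}                []       = []
  All-tailsIn {(true  ∷ A) ∷ 𝓕} (p ∷ ps) = p ∷ All-tailsIn ps
  All-tailsIn {(false ∷ A) ∷ 𝓕} (p ∷ ps) = All-tailsIn ps

  All-tailsOut : ∀ {𝓕} → All P 𝓕 → All (λ B → P (outside ∷ B)) (tailsOut 𝓕)
  All-tailsOut {[]}                []       = []
  All-tailsOut {(true  ∷ A) ∷ 𝓕} (p ∷ ps) = All-tailsOut ps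
  All-tailsOut {(false ∷ A) ∷ 𝓕} (p ∷ ps) = p ∷ All-tailsOut ps

Unique-tailsIn : ∀ {𝓕 : List (Subset (suc n))} → Unique 𝓕 → Unique (tailsIn 𝓕)
Unique-tailsIn {𝓕 = []}                []       = []
Unique-tailsIn {𝓕 = (true  ∷ A) ∷ 𝓕} (A∉ ∷ u) = All.map (λ A≢ → A≢ ∘ cong (inside ∷_)) (All-tailsIn A∉) ∷ Unique-tailsIn u
Unique-tailsIn {𝓕 = (false ∷ A) ∷ 𝓕} (A∉ ∷ u) = Unique-tailsIn u

Unique-tailsOut : ∀ {𝓕 : List (Subset (suc n))} → Unique 𝓕 → Unique (tailsOut 𝓕)
Unique-tailsOut {𝓕 = []}                []       = []
Unique-tailsOut {𝓕 = (true  ∷ A) ∷ 𝓕} (A∉ ∷ u) = Unique-tailsOut u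
Unique-tailsOut {𝓕 = (false ∷ A) ∷ 𝓕} (A∉ ∷ u) = All.map (λ A≢ → A≢ ∘ cong (outside ∷_)) (All-tailsOut A∉) ∷ Unique-tailsOut u

length-supersets≤C : ∀ (c : Subset n) q (𝓕 : List (Subset n)) → Unique 𝓕 →
                     All (λ A → ∣ A ∣ ≡ ∣ c ∣ + q) 𝓕 → All (c ⊆_) 𝓕 → length 𝓕 ≤ (n ∸ ∣ c ∣) C q
length-supersets≤C {zero} [] zero [] _ _ _ = z≤n
length-supersets≤C {zero} [] zero ([] ∷ []) _ _ _ = s≤s z≤n
length-supersets≤C {zero} [] zero ([] ∷ [] ∷ _) ((≢[] ∷ _) ∷ _) _ _ = contradiction refl ≢[]
length-supersets≤C {zero} [] (suc q) 𝓕 _ sizes _ = ≤-reflexive (cong length (All⇒[] (λ { [] () }) sizes))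
length-supersets≤C {suc n} (inside ∷ c) q 𝓕 u sizes sub = begin
  length 𝓕                                 ≡⟨ length-tails 𝓕 ⟩
  length (tailsIn 𝓕) + length (tailsOut 𝓕) ≡⟨ cong (λ 𝓖 → length (tailsIn 𝓕) + length 𝓖) noTailsOut ⟩
  length (tailsIn 𝓕) + 0                   ≡⟨ +-identityʳ _ ⟩
  length (tailsIn 𝓕)                       ≤⟨ length-supersets≤C c q (tailsIn 𝓕) (Unique-tailsIn u)
                                                 (All.map suc-injective (All-tailsIn sizes))
                                                 (All.map drop-∷-⊆ (All-tailsIn sub)) ⟩
  (n ∸ ∣ c ∣) C q                          ∎
  where
  open ≤-Reasoning
  noTailsOut : tailsOut 𝓕 ≡ []
  noTailsOut = All⇒[] (λ B c⊆B → case c⊆B here of λ ()) (All-tailsOut sub)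
length-supersets≤C {suc n} (outside ∷ c) zero 𝓕 u sizes sub = begin
  length 𝓕                                 ≡⟨ length-tails 𝓕 ⟩
  length (tailsIn 𝓕) + length (tailsOut 𝓕) ≡⟨ cong (λ 𝓖 → length 𝓖 + length (tailsOut 𝓕)) noTailsIn ⟩
  length (tailsOut 𝓕)                      ≤⟨ length-supersets≤C c zero (tailsOut 𝓕) (Unique-tailsOut u)
                                                 (All-tailsOut sizes) (All.map drop-∷-⊆ (All-tailsOut sub)) ⟩
  1                                        ∎
  where
  open ≤-Reasoning
  tooLarge : ∀ B → ∣ inside ∷ B ∣ ≡ ∣ c ∣ + 0 → outside ∷ c ⊆ inside ∷ B → ⊥
  tooLarge B ∣B∣ c⊆B = <⇒≱ (≤-reflexive (trans ∣B∣ (+-identityʳ _))) (p⊆q⇒∣p∣≤∣q∣ (drop-∷-⊆ c⊆B))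
  noTailsIn : tailsIn 𝓕 ≡ []
  noTailsIn = All⇒[] (λ B (∣B∣ , c⊆B) → tooLarge B ∣B∣ c⊆B) (All-tailsIn (All.zip (sizes , sub)))
length-supersets≤C {suc n} (outside ∷ c) (suc q) 𝓕 u sizes sub = begin
  length 𝓕                                  ≡⟨ length-tails 𝓕 ⟩
  length (tailsIn 𝓕) + length (tailsOut 𝓕)  ≤⟨ +-mono-≤ boundIn boundOut ⟩
  (n ∸ ∣ c ∣) C q + (n ∸ ∣ c ∣) C (suc q)   ≡⟨ nCk+nC[k+1]≡[n+1]C[k+1] (n ∸ ∣ c ∣) q ⟩
  suc (n ∸ ∣ c ∣) C suc q                   ≡⟨ cong (_C suc q) (sym (+-∸-assoc 1 (∣p∣≤n c))) ⟩
  (suc n ∸ ∣ c ∣) C suc q                   ∎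
  where
  open ≤-Reasoning
  boundIn = length-supersets≤C c q (tailsIn 𝓕) (Unique-tailsIn u)
              (All.map (λ ∣B∣ → suc-injective (trans ∣B∣ (+-suc _ _))) (All-tailsIn sizes))
              (All.map drop-∷-⊆ (All-tailsIn sub))
  boundOut = length-supersets≤C c (suc q) (tailsOut 𝓕) (Unique-tailsOut u)
               (All-tailsOut sizes) (All.map drop-∷-⊆ (All-tailsOut sub))

∣⁅x⁆∪⁅y⁆∣≡2 : ∀ (x y : Fin n) → x ≢ y → ∣ ⁅ x ⁆ ∪ ⁅ y ⁆ ∣ ≡ 2
∣⁅x⁆∪⁅y⁆∣≡2 zero    zero    x≢y = contradiction refl x≢y
∣⁅x⁆∪⁅y⁆∣≡2 zero    (suc y) _   = cong suc (trans (cong ∣_∣ (∪-identityˡ ⁅ y ⁆)) (∣⁅x⁆∣≡1 y))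
∣⁅x⁆∪⁅y⁆∣≡2 (suc x) zero    _   = cong suc (trans (cong ∣_∣ (∪-identityʳ ⁅ x ⁆)) (∣⁅x⁆∣≡1 x))
∣⁅x⁆∪⁅y⁆∣≡2 (suc x) (suc y) x≢y = ∣⁅x⁆∪⁅y⁆∣≡2 x y (x≢y ∘ cong suc)

⁅x⁆∪⁅y⁆⊆ : ∀ {x y : Fin n} {A} → x ∈ A → y ∈ A → ⁅ x ⁆ ∪ ⁅ y ⁆ ⊆ A
⁅x⁆∪⁅y⁆⊆ {x = x} {y} {A} x∈A y∈A z∈ =
  [ (λ z∈⁅x⁆ → subst (_∈ A) (sym (x∈⁅y⁆⇒x≡y x z∈⁅x⁆)) x∈A)
  , (λ z∈⁅y⁆ → subst (_∈ A) (sym (x∈⁅y⁆⇒x≡y y z∈⁅y⁆)) y∈A) ]′ (x∈p∪q⁻ ⁅ x ⁆ ⁅ y ⁆ z∈)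

codegree≤C : ∀ {k} (𝓕 : List (Subset n)) → Unique 𝓕 → All (λ A → ∣ A ∣ ≡ k) 𝓕 → 2 ≤ k →
             ∀ {x y} → x ≢ y → degree (famAt 𝓕 x) y ≤ (n ∸ 2) C (k ∸ 2)
codegree≤C {n} {k} 𝓕 distinct sizes 2≤k {x} {y} x≢y =
  subst (λ s → length 𝓕xy ≤ (n ∸ s) C (k ∸ 2)) (∣⁅x⁆∪⁅y⁆∣≡2 x y x≢y)
    (length-supersets≤C (⁅ x ⁆ ∪ ⁅ y ⁆) (k ∸ 2) 𝓕xy
      (Unique.filter⁺ (y ∈?_) (Unique.filter⁺ (x ∈?_) distinct))
      (All.map (λ ∣A∣ → trans ∣A∣ (sym ∣pair∣+[k∸2]≡k)) (filter⁺ (y ∈?_) (filter⁺ (x ∈?_) sizes)))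
      (All.zipWith (λ (x∈A , y∈A) {z} → ⁅x⁆∪⁅y⁆⊆ x∈A y∈A {z})
        (filter⁺ (y ∈?_) (all-filter (x ∈?_) 𝓕) , all-filter (y ∈?_) (famAt 𝓕 x))))
  where
  𝓕xy = famAt (famAt 𝓕 x) y
  ∣pair∣+[k∸2]≡k : ∣ ⁅ x ⁆ ∪ ⁅ y ⁆ ∣ + (k ∸ 2) ≡ k
  ∣pair∣+[k∸2]≡k = trans (cong (_+ (k ∸ 2)) (∣⁅x⁆∪⁅y⁆∣≡2 x y x≢y)) (m+[n∸m]≡n 2≤k)

-- Binomial coefficients

[1+n]C2≡n+nC2 : ∀ n → suc n C 2 ≡ n + n C 2
[1+n]C2≡n+nC2 n = trans (sym (nCk+nC[k+1]≡[n+1]C[k+1] n 1)) (cong (_+ n C 2) (nC1≡n n))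

n≤1+nC2 : ∀ n → n ≤ 1 + n C 2
n≤1+nC2 zero    = z≤n
n≤1+nC2 (suc n) = s≤s (subst (n ≤_) (sym ([1+n]C2≡n+nC2 n)) (m≤m+n n (n C 2)))

nC2≤n*n : ∀ n → n C 2 ≤ n * n
nC2≤n*n zero    = z≤n
nC2≤n*n (suc n) = begin
  suc n C 2      ≡⟨ [1+n]C2≡n+nC2 n ⟩
  n + n C 2      ≤⟨ +-monoʳ-≤ n (nC2≤n*n n) ⟩
  n + n * n      ≡⟨ *-suc n n ⟨
  n * suc n      ≤⟨ m≤n+m (n * suc n) (suc n) ⟩
  suc n * suc n  ∎
  where open ≤-Reasoning

C-monoˡ-≤ : ∀ {m n} k → m ≤ n → m C k ≤ n C k
C-monoˡ-≤ {m} {n} k m≤n with ≤⇒≤′ m≤n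
... | ≤′-refl       = ≤-refl
... | ≤′-step m≤′n' = ≤-trans (C-monoˡ-≤ k (≤′⇒≤ m≤′n')) (C≤[1+n]C k)
  where
  C≤[1+n]C : ∀ {n} k → n C k ≤ suc n C k
  C≤[1+n]C zero    = ≤-refl
  C≤[1+n]C {n} (suc k) = subst (n C suc k ≤_) (nCk+nC[k+1]≡[n+1]C[k+1] n k) (m≤n+m _ _)

[1+k]*[1+n]C[1+k]≡[1+n]*nCk : ∀ n k → suc k * (suc n C suc k) ≡ suc n * (n C k)
[1+k]*[1+n]C[1+k]≡[1+n]*nCk zero    zero    = refl
[1+k]*[1+n]C[1+k]≡[1+n]*nCk zero    (suc k) = *-zeroʳ (suc (suc k))
[1+k]*[1+n]C[1+k]≡[1+n]*nCk (suc n) zero    = trans (+-identityʳ _) (trans (nC1≡n (suc (suc n))) (sym (*-identityʳ _)))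
[1+k]*[1+n]C[1+k]≡[1+n]*nCk (suc n) (suc k) = begin
  suc (suc k) * (suc (suc n) C suc (suc k))
    ≡⟨ cong (suc (suc k) *_) (nCk+nC[k+1]≡[n+1]C[k+1] (suc n) (suc k)) ⟨
  suc (suc k) * (c₁ + c₂)
    ≡⟨ distribute (suc k) c₁ c₂ ⟩
  c₁ + (suc k * c₁ + suc (suc k) * c₂)
    ≡⟨ cong₂ (λ a b → c₁ + (a + b)) ([1+k]*[1+n]C[1+k]≡[1+n]*nCk n k) ([1+k]*[1+n]C[1+k]≡[1+n]*nCk n (suc k)) ⟩
  c₁ + (suc n * (n C k) + suc n * (n C suc k))
    ≡⟨ cong (c₁ +_) (*-distribˡ-+ (suc n) (n C k) (n C suc k)) ⟨
  c₁ + suc n * (n C k + n C suc k)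
    ≡⟨ cong (λ a → c₁ + suc n * a) (nCk+nC[k+1]≡[n+1]C[k+1] n k) ⟩
  suc (suc n) * c₁ ∎
  where
  open ≡-Reasoning
  c₁ = suc n C suc k
  c₂ = suc n C suc (suc k)
  distribute : ∀ j a b → suc j * (a + b) ≡ a + (j * a + suc j * b)
  distribute = solve-∀

nCk>0 : ∀ {n k} → k ≤ n → 0 < n C k
nCk>0 {n}     {zero}  _         = s≤s z≤n
nCk>0 {suc n} {suc k} (s≤s k≤n) = subst (0 <_) (nCk+nC[k+1]≡[n+1]C[k+1] n k) (<-≤-trans (nCk>0 k≤n) (m≤m+n _ _))

[𝟙+m]C2 : ∀ b m → (𝟙 b + m) C 2 ≡ m C 2 + 𝟙 b * m
[𝟙+m]C2 true  m = trans ([1+n]C2≡n+nC2 m) (trans (+-comm m (m C 2)) (cong (m C 2 +_) (sym (*-identityˡ m))))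
[𝟙+m]C2 false m = sym (+-identityʳ (m C 2))

-- Degrees in a uniform family

module _ {k} (𝓕 : List (Subset n)) (distinct : Unique 𝓕) (sizes : All (λ A → ∣ A ∣ ≡ k) 𝓕) (2≤k : 2 ≤ k) where

  ∑-pairs≤ : ∀ X → Unique X →
             ∑[ A ∈ 𝓕 ] ((∑[ x ∈ X ] ⟦ x ∈ A ⟧) C 2) ≤ (length X C 2) * ((n ∸ 2) C (k ∸ 2))
  ∑-pairs≤ []       _            = ≤-reflexive (trans (∑-const 𝓕 0) (*-zeroʳ (length 𝓕)))
  ∑-pairs≤ (z ∷ X) (z∉X ∷ uX) = begin
    ∑[ A ∈ 𝓕 ] ((⟦ z ∈ A ⟧ + hits A) C 2)
      ≡⟨ ∑-cong 𝓕 (λ A → [𝟙+m]C2 (does (z ∈? A)) (hits A)) ⟩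
    ∑[ A ∈ 𝓕 ] (hits A C 2 + ⟦ z ∈ A ⟧ * hits A)
      ≡⟨ ∑-+ 𝓕 (λ A → hits A C 2) (λ A → ⟦ z ∈ A ⟧ * hits A) ⟩
    ∑[ A ∈ 𝓕 ] (hits A C 2) + ∑[ A ∈ 𝓕 ] (⟦ z ∈ A ⟧ * hits A)
      ≡⟨ cong (∑[ A ∈ 𝓕 ] (hits A C 2) +_) (trans (∑-filter (z ∈?_) 𝓕 hits) (sym (∑-degree (famAt 𝓕 z) X))) ⟩
    ∑[ A ∈ 𝓕 ] (hits A C 2) + ∑ X (degree (famAt 𝓕 z))
      ≤⟨ +-mono-≤ (∑-pairs≤ X uX) (∑-mono (All.map (codegree≤C 𝓕 distinct sizes 2≤k) z∉X)) ⟩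
    (l C 2) * C₂ + ∑[ _ ∈ X ] C₂
      ≡⟨ cong ((l C 2) * C₂ +_) (∑-const X C₂) ⟩
    (l C 2) * C₂ + l * C₂
      ≡⟨ *-distribʳ-+ C₂ (l C 2) l ⟨
    (l C 2 + l) * C₂
      ≡⟨ cong (_* C₂) (trans ([1+n]C2≡n+nC2 l) (+-comm l (l C 2))) ⟨
    (suc l C 2) * C₂ ∎
    where
    open ≤-Reasoning
    hits : Subset n → ℕ
    hits A = ∑[ x ∈ X ] ⟦ x ∈ A ⟧
    l = length X
    C₂ = (n ∸ 2) C (k ∸ 2)

  -- Bonferroni: a member meeting X in j points has j ≤ 1 + C(j,2).
  ∑-degree≤ : ∀ X → Unique X → ∑ X (degree 𝓕) ≤ length 𝓕 + (length X C 2) * ((n ∸ 2) C (k ∸ 2))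
  ∑-degree≤ X uX = begin
    ∑ X (degree 𝓕)
      ≡⟨ ∑-degree 𝓕 X ⟩
    ∑[ A ∈ 𝓕 ] hits A
      ≤⟨ ∑-mono (All.universal (λ A → n≤1+nC2 (hits A)) 𝓕) ⟩
    ∑[ A ∈ 𝓕 ] (1 + hits A C 2)
      ≡⟨ ∑-+ 𝓕 (λ _ → 1) (λ A → hits A C 2) ⟩
    ∑[ _ ∈ 𝓕 ] 1 + ∑[ A ∈ 𝓕 ] (hits A C 2)
      ≡⟨ cong (_+ ∑[ A ∈ 𝓕 ] (hits A C 2)) (trans (∑-const 𝓕 1) (*-identityʳ (length 𝓕))) ⟩
    length 𝓕 + ∑[ A ∈ 𝓕 ] (hits A C 2)
      ≤⟨ +-monoʳ-≤ (length 𝓕) (∑-pairs≤ X uX) ⟩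
    length 𝓕 + (length X C 2) * ((n ∸ 2) C (k ∸ 2)) ∎
    where
    open ≤-Reasoning
    hits : Subset n → ℕ
    hits A = ∑[ x ∈ X ] ⟦ x ∈ A ⟧

  few-vertices-of-high-degree : ∀ s .{{_ : NonZero s}} X → Unique X →
    All (λ x → length 𝓕 ≤ s * degree 𝓕 x) X →
    ((2 * s) C 2) * ((n ∸ 2) C (k ∸ 2)) < length 𝓕 → length X < 2 * s
  few-vertices-of-high-degree s X uX high pairs<m with 2 * s ≤? length X
  ... | no  2s≰∣X∣ = ≰⇒> 2s≰∣X∣
  ... | yes 2s≤∣X∣ = contradiction (+-cancelˡ-≤ m m _ (*-cancelˡ-≤ s chain)) (<⇒≱ pairs<m)
    where
    open ≤-Reasoning
    m = length 𝓕
    C₂ = (n ∸ 2) C (k ∸ 2)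
    X′ = take (2 * s) X
    ∣X′∣≡2s : length X′ ≡ 2 * s
    ∣X′∣≡2s = trans (List.length-take (2 * s) X) (m≤n⇒m⊓n≡m 2s≤∣X∣)
    chain : s * (m + m) ≤ s * (m + ((2 * s) C 2) * C₂)
    chain = begin
      s * (m + m)                      ≡⟨ double s m ⟩
      2 * s * m                        ≡⟨ cong (_* m) ∣X′∣≡2s ⟨
      length X′ * m                    ≡⟨ ∑-const X′ m ⟨
      ∑[ _ ∈ X′ ] m                    ≤⟨ ∑-mono (All.take⁺ (2 * s) high) ⟩
      ∑[ x ∈ X′ ] (s * degree 𝓕 x)     ≡⟨ ∑-*ˡ X′ s (degree 𝓕) ⟩
      s * ∑ X′ (degree 𝓕)              ≤⟨ *-monoʳ-≤ s (∑-degree≤ X′ (Unique.take⁺ (2 * s) uX)) ⟩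
      s * (m + (length X′ C 2) * C₂)   ≡⟨ cong (λ l → s * (m + (l C 2) * C₂)) ∣X′∣≡2s ⟩
      s * (m + ((2 * s) C 2) * C₂)     ∎
      where
      double : ∀ s m → s * (m + m) ≡ 2 * s * m
      double = solve-∀

  degrees-not-all-low : ∀ R .{{_ : NonZero R}} →
    length 𝓕 * length 𝓕 ≤ R * I 𝓕 →
    ((2 * (k * (4 * R))) C 2) * ((n ∸ 2) C (k ∸ 2)) < length 𝓕 →
    ¬ All (λ x → 4 * R * degree 𝓕 x < length 𝓕) (allFin n)
  degrees-not-all-low R m²≤RI pairs<m low = <⇒≱ 4m²<3m² (*-monoˡ-≤ (m * m) {3} {4} (s≤s (s≤s (s≤s z≤n))))
    where
    m = length 𝓕
    q = 4 * R
    s = k * q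
    T = (2 * s) C 2
    C₂ = (n ∸ 2) C (k ∸ 2)
    V = allFin n
    d = degree 𝓕
    instance
      k≢0 : NonZero k
      k≢0 = >-nonZero (≤-trans (s≤s z≤n) 2≤k)
      q≢0 : NonZero q
      q≢0 = m*n≢0 4 R
      s≢0 : NonZero s
      s≢0 = m*n≢0 k q
      m≢0 : NonZero m
      m≢0 = >-nonZero (≤-<-trans z≤n pairs<m)
    isHigh? = λ x → m ≤? s * d x
    H = filter isHigh? V
    L = filter (∁? isHigh?) V
    open ≤-Reasoning

    ∑L≤mk : ∑ L d ≤ m * k
    ∑L≤mk = begin
      ∑ L d             ≤⟨ m≤n+m (∑ L d) (∑ H d) ⟩
      ∑ H d + ∑ L d     ≡⟨ ∑-partition isHigh? V d ⟨
      ∑ V d             ≡⟨ ∑-degree-allFin 𝓕 ⟩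
      ∑ 𝓕 ∣_∣           ≡⟨ ∑-const-All sizes ⟩
      m * k             ∎

    low-part : q * ∑[ x ∈ L ] (d x * d x) ≤ m * m
    low-part = *-cancelˡ-≤ k (begin
      k * (q * ∑[ x ∈ L ] (d x * d x))  ≡⟨ *-assoc k q _ ⟨
      s * ∑[ x ∈ L ] (d x * d x)        ≤⟨ ∑-square≤ s m (All.map (<⇒≤ ∘ ≰⇒>) (all-filter (∁? isHigh?) V)) ⟩
      m * ∑ L d                         ≤⟨ *-monoʳ-≤ m ∑L≤mk ⟩
      m * (m * k)                       ≡⟨ *-assoc m m k ⟨
      m * m * k                         ≡⟨ *-comm (m * m) k ⟩
      k * (m * m)                       ∎)

    high-part : q * ∑[ x ∈ H ] (d x * d x) ≤ m * (m + T * C₂)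
    high-part = begin
      q * ∑[ x ∈ H ] (d x * d x)  ≤⟨ ∑-square≤ q m (All.map <⇒≤ (filter⁺ isHigh? low)) ⟩
      m * ∑ H d                   ≤⟨ *-monoʳ-≤ m (∑-degree≤ H uH) ⟩
      m * (m + (length H C 2) * C₂)
                                  ≤⟨ *-monoʳ-≤ m (+-monoʳ-≤ m (*-monoˡ-≤ C₂ (C-monoˡ-≤ 2 (<⇒≤ ∣H∣<2s)))) ⟩
      m * (m + T * C₂)            ∎
      where
      uH = Unique.filter⁺ isHigh? (Unique.allFin⁺ n)
      ∣H∣<2s = few-vertices-of-high-degree s H uH (all-filter isHigh? V) pairs<m

    4m²<3m² : 4 * (m * m) < 3 * (m * m)
    4m²<3m² = begin-strict
      4 * (m * m)                                          ≤⟨ *-monoʳ-≤ 4 m²≤RI ⟩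
      4 * (R * I 𝓕)                                        ≡⟨ *-assoc 4 R (I 𝓕) ⟨
      q * I 𝓕                                              ≡⟨ cong (q *_) (trans (I≡∑degree² 𝓕) (∑-partition isHigh? V (λ x → d x * d x))) ⟩
      q * (∑[ x ∈ H ] (d x * d x) + ∑[ x ∈ L ] (d x * d x)) ≡⟨ *-distribˡ-+ q _ _ ⟩
      q * ∑[ x ∈ H ] (d x * d x) + q * ∑[ x ∈ L ] (d x * d x) ≤⟨ +-mono-≤ high-part low-part ⟩
      m * (m + T * C₂) + m * m                             <⟨ +-monoˡ-< (m * m) (*-monoʳ-< m (+-monoʳ-< m pairs<m)) ⟩
      m * (m + m) + m * m                                  ≡⟨ three m ⟩
      3 * (m * m)                                          ∎
      where
      three : ∀ m → m * (m + m) + m * m ≡ 3 * (m * m)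
      three = solve-∀

  high-degree-vertex : ∀ R .{{_ : NonZero R}} →
    length 𝓕 * length 𝓕 ≤ R * I 𝓕 →
    ((2 * (k * (4 * R))) C 2) * ((n ∸ 2) C (k ∸ 2)) < length 𝓕 →
    ∃ λ x → length 𝓕 ≤ 4 * R * degree 𝓕 x
  high-degree-vertex R m²≤RI pairs<m with any? (λ x → length 𝓕 ≤? 4 * R * degree 𝓕 x) (allFin n)
  ... | yes high = satisfied high
  ... | no  ¬high = contradiction (All.map ≰⇒> (¬Any⇒All¬ (allFin n) ¬high)) (degrees-not-all-low R m²≤RI pairs<m)

-- Numerical bounds

C[8kR]2≤64k²R² : ∀ k R → (2 * (k * (4 * R))) C 2 ≤ 64 * (k * k) * (R * R)
C[8kR]2≤64k²R² k R = ≤-trans (nC2≤n*n (2 * (k * (4 * R)))) (≤-reflexive (square k R))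
  where
  square : ∀ k R → 2 * (k * (4 * R)) * (2 * (k * (4 * R))) ≡ 64 * (k * k) * (R * R)
  square = solve-∀

-- The hypothesis a + Tkn < an is a subtraction-free strengthening of T(k − 1)n < a(n − 1).
T*[n∸2]C[k∸2]<m : ∀ {k n m} T a → 2 ≤ k → k ≤ n →
                  a * ((n ∸ 1) C (k ∸ 1)) ≤ m * n → a + T * k * n < a * n →
                  T * ((n ∸ 2) C (k ∸ 2)) < m
T*[n∸2]C[k∸2]<m {suc K@(suc k′)} {n@(suc N@(suc n′))} {m} T a (s≤s (s≤s _)) (s≤s (s≤s k′≤n′)) aC₁≤mn a+Tkn<an =
  *-cancelˡ-< (K * n) _ _ (begin-strict
    K * n * (T * C₂)  ≡⟨ reorder K n T C₂ ⟩
    T * K * n * C₂    <⟨ *-monoˡ-< C₂ TKn<aN ⟩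
    a * N * C₂        ≡⟨ *-assoc a N C₂ ⟩
    a * (N * C₂)      ≡⟨ cong (a *_) absorption ⟨
    a * (K * C₁)      ≡⟨ x∙yz≈y∙xz a K C₁ ⟩
    K * (a * C₁)      ≤⟨ *-monoʳ-≤ K aC₁≤mn ⟩
    K * (m * n)       ≡⟨ x∙yz≈xz∙y K m n ⟩
    K * n * m         ∎)
  where
  open ≤-Reasoning
  open CommSemigroupProperties *-commutativeSemigroup using (x∙yz≈y∙xz; x∙yz≈xz∙y)
  C₁ = N C K
  C₂ = n′ C k′
  instance
    C₂≢0 : NonZero C₂
    C₂≢0 = >-nonZero (nCk>0 k′≤n′)
  absorption : K * C₁ ≡ N * C₂
  absorption = [1+k]*[1+n]C[1+k]≡[1+n]*nCk n′ k′
  TKn<aN : T * K * n < a * N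
  TKn<aN = ≤-<-trans (*-monoˡ-≤ n (*-monoʳ-≤ T (n≤1+n K)))
                     (+-cancelˡ-< a _ _ (subst (a + T * suc K * n <_) (*-suc a N) a+Tkn<an))
  reorder : ∀ K n T C₂ → K * n * (T * C₂) ≡ T * K * n * C₂
  reorder = solve-∀

n≥3000R²k³ : ∀ C₀ k r n → 3000 ≤ C₀ → C₀ * (r + 1) ^ 3 * (k + r) * k ^ 2 ≤ n →
             3000 * ((r + 1) * (r + 1) * (k * k * k)) ≤ n
n≥3000R²k³ C₀ k r n 3000≤C₀ n-large = begin
  3000 * (R * R * (k * k * k))       ≤⟨ m≤m*n (3000 * (R * R * (k * k * k))) R ⟩
  3000 * (R * R * (k * k * k)) * R   ≡⟨ reorder R k ⟩
  3000 * R ^ 3 * k * k ^ 2           ≤⟨ *-monoˡ-≤ (k ^ 2) (*-mono-≤ (*-monoˡ-≤ (R ^ 3) 3000≤C₀) (m≤m+n k r)) ⟩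
  C₀ * R ^ 3 * (k + r) * k ^ 2       ≤⟨ n-large ⟩
  n                                  ∎
  where
  open ≤-Reasoning
  R = r + 1
  instance
    R≢0 : NonZero R
    R≢0 = ≢-nonZero (m+1+n≢0 r)
  -- The ring solver does not accept _^_, so powers appear unfolded.
  reorder : ∀ R k → 3000 * (R * R * (k * k * k)) * R ≡ 3000 * (R * (R * (R * 1))) * k * (k * (k * 1))
  reorder = solve-∀

k≤3000R²k³ : ∀ k R → 1 ≤ k → 1 ≤ R → k ≤ 3000 * (R * R * (k * k * k))
k≤3000R²k³ k@(suc _) R@(suc _) _ _ = begin
  k                                ≤⟨ m≤n*m k (k * k) ⟩
  k * k * k                        ≤⟨ m≤n*m (k * k * k) (R * R) ⟩
  R * R * (k * k * k)              ≤⟨ m≤n*m (R * R * (k * k * k)) 3000 ⟩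
  3000 * (R * R * (k * k * k))     ∎
  where open ≤-Reasoning

n+Tkn<n² : ∀ {k R n T} → 1 ≤ k → 1 ≤ R → T ≤ 64 * (k * k) * (R * R) →
           3000 * (R * R * (k * k * k)) ≤ n → n + T * k * n < n * n
n+Tkn<n² {k} {R} {n} {T} 1≤k 1≤R T≤ 3000X≤n = begin-strict
  n + T * k * n    ≡⟨ factor n (T * k) ⟩
  (1 + T * k) * n  <⟨ *-monoˡ-< n 1+Tk<n ⟩
  n * n            ∎
  where
  open ≤-Reasoning
  X = R * R * (k * k * k)
  1≤X : 1 ≤ X
  1≤X = *-mono-≤ (*-mono-≤ 1≤R 1≤R) (*-mono-≤ (*-mono-≤ 1≤k 1≤k) 1≤k)
  1+Tk<n : 1 + T * k < n
  1+Tk<n = begin-strict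
    1 + T * k                       ≤⟨ +-monoʳ-≤ 1 (*-monoˡ-≤ k T≤) ⟩
    1 + 64 * (k * k) * (R * R) * k  ≡⟨ cong (1 +_) (regroup k R) ⟩
    1 + 64 * X                      <⟨ +-monoˡ-≤ (64 * X) (*-monoʳ-≤ 2 1≤X) ⟩
    2 * X + 64 * X                  ≡⟨ *-distribʳ-+ X 2 64 ⟨
    66 * X                          ≤⟨ *-monoˡ-≤ X (m≤m+n 66 2934) ⟩
    3000 * X                        ≤⟨ 3000X≤n ⟩
    n                               ∎
    where
    regroup : ∀ k R → 64 * (k * k) * (R * R) * k ≡ 64 * (R * R * (k * k * k))
    regroup = solve-∀
  instance
    n≢0 : NonZero n
    n≢0 = >-nonZero (<-≤-trans (s≤s z≤n) 1+Tk<n)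
  factor : ∀ n a → n + a * n ≡ (1 + a) * n
  factor = solve-∀

150k³+Tkn<150k³n : ∀ {k n T} → 1 ≤ k → 2 ≤ n → T ≤ 64 * (k * k) → 150 * k ^ 3 + T * k * n < 150 * k ^ 3 * n
150k³+Tkn<150k³n {k} {n@(suc (suc j))} {T} 1≤k (s≤s (s≤s _)) T≤ = begin-strict
  150 * k ^ 3 + T * k * n             ≤⟨ +-monoʳ-≤ (150 * k ^ 3) (*-monoˡ-≤ n (*-monoˡ-≤ k T≤)) ⟩
  150 * k ^ 3 + 64 * (k * k) * k * n  ≡⟨ factor k n ⟩
  k³ * (150 + 64 * n)                 <⟨ *-monoʳ-< k³ 150+64n<150n ⟩
  k³ * (150 * n)                      ≡⟨ unfactor k n ⟩
  150 * k ^ 3 * n                     ∎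
  where
  open ≤-Reasoning
  k³ = k * k * k
  instance
    k³≢0 : NonZero k³
    k³≢0 = >-nonZero (*-mono-≤ (*-mono-≤ 1≤k 1≤k) 1≤k)
  150+64n<150n : 150 + 64 * n < 150 * n
  150+64n<150n = begin-strict
    150 + 64 * n    ≡⟨ shift j ⟩
    278 + 64 * j    <⟨ +-mono-<-≤ (m≤m+n 279 21) (*-monoˡ-≤ j (m≤m+n 64 86)) ⟩
    300 + 150 * j   ≡⟨ shift′ j ⟨
    150 * n         ∎
    where
    shift : ∀ j → 150 + 64 * suc (suc j) ≡ 278 + 64 * j
    shift = solve-∀
    shift′ : ∀ j → 150 * suc (suc j) ≡ 300 + 150 * j
    shift′ = solve-∀
  factor : ∀ k n → 150 * (k * (k * (k * 1))) + 64 * (k * k) * k * n ≡ k * k * k * (150 + 64 * n)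
  factor = solve-∀
  unfactor : ∀ k n → k * k * k * (150 * n) ≡ 150 * (k * (k * (k * 1))) * n
  unfactor = solve-∀

-- The embedding of ℕ into ℚ

ℕ→ℚ≡mkℚ : ∀ a → ℕ→ℚ a ≡ mkℚ (ℤ.+ a) 0 (Coprime.sym (Coprime.1-coprimeTo a))
ℕ→ℚ≡mkℚ a = ℚ.normalize-coprime (Coprime.sym (Coprime.1-coprimeTo a))

ℕ→ℚ-homo-+ : ∀ a b → ℕ→ℚ (a + b) ≡ ℕ→ℚ a ℚ.+ ℕ→ℚ b
ℕ→ℚ-homo-+ a b rewrite ℕ→ℚ≡mkℚ a | ℕ→ℚ≡mkℚ b =
  cong (_/ 1) (sym (cong₂ ℤ._+_ (ℤ.*-identityʳ (ℤ.+ a)) (ℤ.*-identityʳ (ℤ.+ b))))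

ℕ→ℚ-homo-* : ∀ a b → ℕ→ℚ (a * b) ≡ ℕ→ℚ a ℚ.* ℕ→ℚ b
ℕ→ℚ-homo-* a b rewrite ℕ→ℚ≡mkℚ a | ℕ→ℚ≡mkℚ b = cong (_/ 1) (ℤ.pos-* a b)

ℕ→ℚ-mono-≤ : ∀ {a b} → a ≤ b → ℕ→ℚ a ℚ.≤ ℕ→ℚ b
ℕ→ℚ-mono-≤ {a} {b} a≤b rewrite ℕ→ℚ≡mkℚ a | ℕ→ℚ≡mkℚ b =
  *≤* (subst₂ ℤ._≤_ (sym (ℤ.*-identityʳ (ℤ.+ a))) (sym (ℤ.*-identityʳ (ℤ.+ b))) (ℤ.+≤+ a≤b))

ℕ→ℚ-cancel-≤ : ∀ {a b} → ℕ→ℚ a ℚ.≤ ℕ→ℚ b → a ≤ b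
ℕ→ℚ-cancel-≤ {a} {b} a≤b rewrite ℕ→ℚ≡mkℚ a | ℕ→ℚ≡mkℚ b with a≤b
... | *≤* a≤b′ = ℤ.drop‿+≤+ (subst₂ ℤ._≤_ (ℤ.*-identityʳ (ℤ.+ a)) (ℤ.*-identityʳ (ℤ.+ b)) a≤b′)

0≤ℕ→ℚ : ∀ a → 0ℚ ℚ.≤ ℕ→ℚ a
0≤ℕ→ℚ a = ℕ→ℚ-mono-≤ {0} {a} z≤n

0≤x*x : ∀ x → 0ℚ ℚ.≤ x ℚ.* x
0≤x*x x with ℚ.≤-total 0ℚ x
... | inj₁ 0≤x = subst (ℚ._≤ x ℚ.* x) (ℚ.*-zeroʳ x) (ℚ.*-monoˡ-≤-nonNeg x {{ℚ.nonNegative 0≤x}} 0≤x)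
... | inj₂ x≤0 = subst (ℚ._≤ x ℚ.* x) (ℚ.*-zeroʳ x) (ℚ.*-monoˡ-≤-nonPos x {{ℚ.nonPositive x≤0}} x≤0)

[r+δ]²≤[r+1][r+δ²] : ∀ r δ → 0ℚ ℚ.≤ r → (r ℚ.+ δ) ℚ.* (r ℚ.+ δ) ℚ.≤ (r ℚ.+ 1ℚ) ℚ.* (r ℚ.+ δ ℚ.* δ)
[r+δ]²≤[r+1][r+δ²] r δ 0≤r = begin
  (r ℚ.+ δ) ℚ.* (r ℚ.+ δ)                         ≡⟨ ℚ.+-identityʳ _ ⟨
  (r ℚ.+ δ) ℚ.* (r ℚ.+ δ) ℚ.+ 0ℚ                  ≤⟨ ℚ.+-monoʳ-≤ ((r ℚ.+ δ) ℚ.* (r ℚ.+ δ)) 0≤r[δ-1]² ⟩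
  (r ℚ.+ δ) ℚ.* (r ℚ.+ δ) ℚ.+ r ℚ.* (δ-1 ℚ.* δ-1) ≡⟨ identity r δ ⟨
  (r ℚ.+ 1ℚ) ℚ.* (r ℚ.+ δ ℚ.* δ)                  ∎
  where
  open ℚ.≤-Reasoning
  δ-1 = δ ℚ.- 1ℚ
  0≤r[δ-1]² : 0ℚ ℚ.≤ r ℚ.* (δ-1 ℚ.* δ-1)
  0≤r[δ-1]² = subst (ℚ._≤ r ℚ.* (δ-1 ℚ.* δ-1)) (ℚ.*-zeroʳ r)
                (ℚ.*-monoˡ-≤-nonNeg r {{ℚ.nonNegative 0≤r}} (0≤x*x δ-1))
  identity : ∀ r δ → (r ℚ.+ 1ℚ) ℚ.* (r ℚ.+ δ ℚ.* δ) ≡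
                     (r ℚ.+ δ) ℚ.* (r ℚ.+ δ) ℚ.+ r ℚ.* ((δ ℚ.- 1ℚ) ℚ.* (δ ℚ.- 1ℚ))
  identity = solve 2 (λ r δ → (r :+ con 1ℚ) :* (r :+ δ :* δ) :=
                              (r :+ δ) :* (r :+ δ) :+ r :* ((δ :- con 1ℚ) :* (δ :- con 1ℚ))) refl
    where open +-*-Solver

ℕ→ℚ[a]≤δn⇒0<δ : ∀ {a n δ} → 0 < a → ℕ→ℚ a ℚ.≤ δ ℚ.* ℕ→ℚ n → 0ℚ ℚ.< δ
ℕ→ℚ[a]≤δn⇒0<δ {a} {n} {δ} 0<a a≤δn = ℚ.≰⇒> λ δ≤0 → <⇒≱ 0<a (ℕ→ℚ-cancel-≤ (begin
  ℕ→ℚ a          ≤⟨ a≤δn ⟩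
  δ ℚ.* ℕ→ℚ n    ≤⟨ ℚ.*-monoʳ-≤-nonNeg (ℕ→ℚ n) {{ℚ.nonNegative (0≤ℕ→ℚ n)}} δ≤0 ⟩
  0ℚ ℚ.* ℕ→ℚ n   ≡⟨ ℚ.*-zeroˡ (ℕ→ℚ n) ⟩
  0ℚ             ∎))
  where open ℚ.≤-Reasoning

m²≤[r+1]i : ∀ r i m δ → 0ℚ ℚ.< δ →
  (ℕ→ℚ r ℚ.+ δ ℚ.* δ) ℚ.* (ℕ→ℚ m ℚ.* ℕ→ℚ m) ℚ.≤ ℕ→ℚ i ℚ.* ((ℕ→ℚ r ℚ.+ δ) ℚ.* (ℕ→ℚ r ℚ.+ δ)) →
  m * m ≤ (r + 1) * i
m²≤[r+1]i r i m δ 0<δ hyp = subst (m * m ≤_) (*-comm i (r + 1)) (ℕ→ℚ-cancel-≤ (ℚ.*-cancelʳ-≤-pos e (begin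
  ℕ→ℚ (m * m) ℚ.* e          ≡⟨ cong (ℚ._* e) (ℕ→ℚ-homo-* m m) ⟩
  (M ℚ.* M) ℚ.* e            ≡⟨ ℚ.*-comm (M ℚ.* M) e ⟩
  e ℚ.* (M ℚ.* M)            ≤⟨ hyp ⟩
  Iq ℚ.* (s ℚ.* s)           ≤⟨ ℚ.*-monoˡ-≤-nonNeg Iq {{ℚ.nonNegative (0≤ℕ→ℚ i)}} [R+δ]²≤[R+1]e ⟩
  Iq ℚ.* ((R ℚ.+ 1ℚ) ℚ.* e)  ≡⟨ ℚ.*-assoc Iq (R ℚ.+ 1ℚ) e ⟨
  Iq ℚ.* (R ℚ.+ 1ℚ) ℚ.* e    ≡⟨ cong (λ x → Iq ℚ.* x ℚ.* e) (ℕ→ℚ-homo-+ r 1) ⟨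
  Iq ℚ.* ℕ→ℚ (r + 1) ℚ.* e   ≡⟨ cong (ℚ._* e) (ℕ→ℚ-homo-* i (r + 1)) ⟨
  ℕ→ℚ (i * (r + 1)) ℚ.* e    ∎)))
  where
  open ℚ.≤-Reasoning
  R = ℕ→ℚ r
  M = ℕ→ℚ m
  Iq = ℕ→ℚ i
  e = R ℚ.+ δ ℚ.* δ
  s = R ℚ.+ δ
  [R+δ]²≤[R+1]e = [r+δ]²≤[r+1][r+δ²] R δ (0≤ℕ→ℚ r)
  instance
    δ>0 : Positive δ
    δ>0 = ℚ.positive 0<δ
    e>0 : Positive e
    e>0 = ℚ.positive (ℚ.+-mono-≤-< (0≤ℕ→ℚ r) (ℚ.positive⁻¹ (δ ℚ.* δ) {{ℚ.pos*pos⇒pos δ δ}}))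

ℕ→ℚ[m]≡s+δb⇒s≤m : ∀ {s m b δ} → 0ℚ ℚ.≤ δ → ℕ→ℚ m ≡ ℕ→ℚ s ℚ.+ δ ℚ.* ℕ→ℚ b → s ≤ m
ℕ→ℚ[m]≡s+δb⇒s≤m {s} {m} {b} {δ} 0≤δ m≡s+δb = ℕ→ℚ-cancel-≤ (begin
  ℕ→ℚ s                      ≡⟨ ℚ.+-identityʳ (ℕ→ℚ s) ⟨
  ℕ→ℚ s ℚ.+ 0ℚ               ≤⟨ ℚ.+-monoʳ-≤ (ℕ→ℚ s) 0≤δb ⟩
  ℕ→ℚ s ℚ.+ δ ℚ.* ℕ→ℚ b      ≡⟨ m≡s+δb ⟨
  ℕ→ℚ m                      ∎)
  where
  open ℚ.≤-Reasoning
  0≤δb : 0ℚ ℚ.≤ δ ℚ.* ℕ→ℚ b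
  0≤δb = subst (ℚ._≤ δ ℚ.* ℕ→ℚ b) (ℚ.*-zeroˡ (ℕ→ℚ b))
           (ℚ.*-monoʳ-≤-nonNeg (ℕ→ℚ b) {{ℚ.nonNegative (0≤ℕ→ℚ b)}} 0≤δ)

ℕ→ℚ[m]≡δc⇒ac≤mn : ∀ {a m n c δ} → ℕ→ℚ a ℚ.≤ δ ℚ.* ℕ→ℚ n → ℕ→ℚ m ≡ ℕ→ℚ 0 ℚ.+ δ ℚ.* ℕ→ℚ c →
                  a * c ≤ m * n
ℕ→ℚ[m]≡δc⇒ac≤mn {a} {m} {n} {c} {δ} a≤δn m≡δc = ℕ→ℚ-cancel-≤ (begin
  ℕ→ℚ (a * c)                  ≡⟨ ℕ→ℚ-homo-* a c ⟩
  ℕ→ℚ a ℚ.* ℕ→ℚ c              ≤⟨ ℚ.*-monoʳ-≤-nonNeg (ℕ→ℚ c) {{ℚ.nonNegative (0≤ℕ→ℚ c)}} a≤δn ⟩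
  δ ℚ.* ℕ→ℚ n ℚ.* ℕ→ℚ c        ≡⟨ ℚ.*-assoc δ (ℕ→ℚ n) (ℕ→ℚ c) ⟩
  δ ℚ.* (ℕ→ℚ n ℚ.* ℕ→ℚ c)      ≡⟨ cong (δ ℚ.*_) (ℚ.*-comm (ℕ→ℚ n) (ℕ→ℚ c)) ⟩
  δ ℚ.* (ℕ→ℚ c ℚ.* ℕ→ℚ n)      ≡⟨ ℚ.*-assoc δ (ℕ→ℚ c) (ℕ→ℚ n) ⟨
  δ ℚ.* ℕ→ℚ c ℚ.* ℕ→ℚ n        ≡⟨ cong (ℚ._* ℕ→ℚ n) (trans m≡δc (ℚ.+-identityˡ (δ ℚ.* ℕ→ℚ c))) ⟨
  ℕ→ℚ m ℚ.* ℕ→ℚ n              ≡⟨ ℕ→ℚ-homo-* m n ⟨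
  ℕ→ℚ (m * n)                  ∎)
  where
  open ℚ.≤-Reasoning

-- The size of the family

Σ₁-first≤ : ∀ r f → f 1 ≤ Σ₁ (suc r) f
Σ₁-first≤ zero    f = ≤-refl
Σ₁-first≤ (suc r) f = ≤-trans (Σ₁-first≤ r f) (m≤m+n _ _)

C[8kR]2*[n∸2]C[k∸2]<m : ∀ k r n m δ → 2 ≤ k → 3000 * ((r + 1) * (r + 1) * (k * k * k)) ≤ n →
  ℕ→ℚ (150 * k ^ 3) ℚ.≤ δ ℚ.* ℕ→ℚ n → 0ℚ ℚ.< δ →
  ℕ→ℚ m ≡ ℕ→ℚ (Σ₁ r (λ i → (n ∸ i) C (k ∸ 1))) ℚ.+ δ ℚ.* ℕ→ℚ ((n ∸ (r + 1)) C (k ∸ 1)) →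
  ((2 * (k * (4 * (r + 1)))) C 2) * ((n ∸ 2) C (k ∸ 2)) < m
C[8kR]2*[n∸2]C[k∸2]<m k zero n m δ 2≤k n-large a≤δn _ m≡δC₁ =
  T*[n∸2]C[k∸2]<m ((2 * (k * 4)) C 2) (150 * k ^ 3) 2≤k k≤n
    (ℕ→ℚ[m]≡δc⇒ac≤mn {150 * k ^ 3} {m} {n} {C₁} {δ} a≤δn m≡δC₁)
    (150k³+Tkn<150k³n 1≤k (≤-trans 2≤k k≤n) T≤64k²)
  where
  C₁ = (n ∸ 1) C (k ∸ 1)
  1≤k = ≤-trans (s≤s z≤n) 2≤k
  k≤n = ≤-trans (k≤3000R²k³ k 1 1≤k ≤-refl) n-large
  T≤64k² = ≤-trans (C[8kR]2≤64k²R² k 1) (≤-reflexive (*-identityʳ (64 * (k * k))))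
C[8kR]2*[n∸2]C[k∸2]<m k (suc r) n m δ 2≤k n-large _ 0<δ m≡Σ+δC =
  T*[n∸2]C[k∸2]<m ((2 * (k * (4 * R))) C 2) n 2≤k k≤n
    (≤-trans (*-monoʳ-≤ n C₁≤m) (≤-reflexive (*-comm n m)))
    (n+Tkn<n² 1≤k 1≤R (C[8kR]2≤64k²R² k R) n-large)
  where
  R = suc r + 1
  f = λ i → (n ∸ i) C (k ∸ 1)
  1≤k = ≤-trans (s≤s z≤n) 2≤k
  1≤R = m≤n+m 1 (suc r)
  k≤n = ≤-trans (k≤3000R²k³ k R 1≤k 1≤R) n-large
  C₁≤m : f 1 ≤ m
  C₁≤m = ≤-trans (Σ₁-first≤ r f)
                 (ℕ→ℚ[m]≡s+δb⇒s≤m {Σ₁ (suc r) f} {m} {f R} {δ} (ℚ.<⇒≤ 0<δ) m≡Σ+δC)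

lemma2p1 : (C₀ k r n : ℕ) → 3000 ≤ C₀ → 2 ≤ k
    → C₀ * (r + 1) ^ 3 * (k + r) * k ^ 2 ≤ n
    → (𝓕 : List (Subset n)) → Unique 𝓕 → All (λ A → ∣ A ∣ ≡ k) 𝓕
    → (δ : ℚ)
    → ℕ→ℚ (150 * k ^ 3) ℚ.≤ δ ℚ.* ℕ→ℚ n
    → δ ℚ.≤ ℚ.1ℚ
    → ℕ→ℚ (length 𝓕) ≡ ℕ→ℚ (Σ₁ r (λ i → (n ∸ i) C (k ∸ 1))) ℚ.+ δ ℚ.* ℕ→ℚ ((n ∸ (r + 1)) C (k ∸ 1))
    → (ℕ→ℚ r ℚ.+ δ ℚ.* δ) ℚ.* (ℕ→ℚ (length 𝓕) ℚ.* ℕ→ℚ (length 𝓕))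
        ℚ.≤ ℕ→ℚ (I 𝓕) ℚ.* ((ℕ→ℚ r ℚ.+ δ) ℚ.* (ℕ→ℚ r ℚ.+ δ))
    → ∃ λ (x : Fin n) → length 𝓕 ≤ 4 * (r + 1) * length (famAt 𝓕 x)
lemma2p1 C₀ k r n 3000≤C₀ 2≤k n-large 𝓕 distinct sizes δ 150k³≤δn _ ∣𝓕∣≡ I-large =
  high-degree-vertex 𝓕 distinct sizes 2≤k (r + 1) {{≢-nonZero (m+1+n≢0 r)}}
    (m²≤[r+1]i r (I 𝓕) (length 𝓕) δ δ>0 I-large)
    (C[8kR]2*[n∸2]C[k∸2]<m k r n (length 𝓕) δ 2≤k (n≥3000R²k³ C₀ k r n 3000≤C₀ n-large) 150k³≤δn δ>0 ∣𝓕∣≡)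
  where
  instance
    k≢0 : NonZero k
    k≢0 = >-nonZero (≤-trans (s≤s z≤n) 2≤k)
  δ>0 : 0ℚ ℚ.< δ
  δ>0 = ℕ→ℚ[a]≤δn⇒0<δ {150 * k ^ 3} {n} (*-monoʳ-< 150 (m^n>0 k 3)) 150k³≤δn
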